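{- For any $C\in\{\{0,1\},\{0\},\{1\}\}$ and any natural number $n$, there exists a switching network $P_C$ with $n$ input variables such that $L(P_C)=2n$ and $h_C(P_C)\geq 2^n$.
   Context: A switching network is an undirected connected multigraph $P$ without loops with two distinct fixed nodes called poles, each edge labeled with a literal $x_i$ or $\bar x_i$ ($i\in\{0,1,2,\ldots\}$). $L(P)$ denotes the number of edges. The input variables $x_{i_1},\ldots,x_{i_m}$ of $P$ are all variables occurring in the edge literals. For $C\in\{\{0,1\},\{0\},\{1\}\}$, a $C$-fault of $P$ consists in assigning constants from $C$ to some edges of $P$ instead of their literals (the empty fault $\lambda$, assigning nothing, is allowed). For a $C$-fault $\rho$, $f_{P,\rho}$ is the Boolean function of the input variables equal to the disjunction, over all simple paths $\xi$ between the poles, of the conjunction of the Boolean functions (literals or constants) attached to the edges of $\xi$ in $P$ with fault $\rho$. A decision tree (for diagnosis of $C$-faults of $P$) is a rooted directed tree whose terminal nodes are labeled with $C$-faults of $P$ and whose nonterminal nodes are labeled with tuples from $\{0,1\}^m$, with two outgoing edges labeled $0$ and $1$; on $P$ with fault $\rho$ it starts at the root, at each nonterminal node follows the edge labeled with the value of $f_{P,\rho}$ on the node's tuple, and outputs the fault labeling the reached terminal node. Its depth is the maximum length of a root-to-terminal path. $h_C(P)$ is the minimum depth of a decision tree such that for every $C$-fault $\rho$ of $P$ (including the empty fault) its output $\delta$ satisfies $f_{P,\rho}=f_{P,\delta}$. -}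

module Defs where

open import Data.Nat using (ℕ; zero; suc; _⊔_)
open import Data.Bool using (Bool; true; false; not; if_then_else_)
open import Data.Fin using (Fin)
open import Data.Maybe using (Maybe; just; nothing)
open import Data.Product using (Σ; ∃; _×_; _,_; proj₁; proj₂)
open import Data.Sum using (_⊎_)
open import Data.List using (List; []; _∷_; length)
open import Data.List.Relation.Unary.All using (All)
open import Data.List.Relation.Unary.Unique.Propositional using (Unique)
open import Data.List.Membership.Propositional using (_∈_)
open import Relation.Binary.PropositionalEquality using (_≡_; _≢_)
open import Relation.Nullary using (¬_)
open import Function.Bundles using (_⇔_)

record Literal : Set where
  constructor lit
  field
    var : ℕ
    pos : Bool

evalLit : (ℕ → Bool) → Literal → Bool
evalLit σ (lit i true)  = σ i
evalLit σ (lit i false) = not (σ i)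

Joins : ∀ {k L} → (Fin L → Fin k × Fin k) → Fin L → Fin k → Fin k → Set
Joins ends e u v = (ends e ≡ (u , v)) ⊎ (ends e ≡ (v , u))

-- Walk ends u w vs es : a walk from u to w visiting the node sequence vs
-- (including both endpoints) and using the edge sequence es.
data Walk {k L} (ends : Fin L → Fin k × Fin k)
     : Fin k → Fin k → List (Fin k) → List (Fin L) → Set where
  here : ∀ v → Walk ends v v (v ∷ []) []
  step : ∀ {u v w vs es} (e : Fin L) → Joins ends e u v →
         Walk ends v w vs es → Walk ends u w (u ∷ vs) (e ∷ es)

record Network : Set where
  field
    nodes     : ℕ
    L         : ℕ
    ends      : Fin L → Fin nodes × Fin nodes
    label     : Fin L → Literal
    noLoop    : ∀ e → proj₁ (ends e) ≢ proj₂ (ends e)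
    pole₁     : Fin nodes
    pole₂     : Fin nodes
    poles≢    : pole₁ ≢ pole₂
    connected : ∀ u v → Σ (List (Fin nodes)) λ vs →
                  Σ (List (Fin L)) λ es → Walk ends u v vs es

open Network public

Occurs : Network → ℕ → Set
Occurs P i = ∃ λ (e : Fin (L P)) → Literal.var (label P e) ≡ i

HasInputVars : Network → ℕ → Set
HasInputVars P n = Σ (List ℕ) λ vs →
  Unique vs × length vs ≡ n × (∀ i → (i ∈ vs) ⇔ Occurs P i)

data FaultType : Set where
  C01 C0 C1 : FaultType

InC : FaultType → Bool → Set
InC C01 b = b ≡ b
InC C0  b = b ≡ false
InC C1  b = b ≡ true

-- A C-fault of a network with L edges: each edge is either left alone
-- (nothing) or assigned a constant from C.  The empty fault is λ _ → nothing.
Fault : FaultType → ℕ → Set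
Fault C L = Fin L → Maybe (Σ Bool (InC C))

edgeVal : (P : Network) {C : FaultType} → Fault C (L P) → (ℕ → Bool) → Fin (L P) → Bool
edgeVal P ρ σ e with ρ e
... | just (b , _) = b
... | nothing      = evalLit σ (label P e)

-- f_{P,ρ}(σ) = 1 : some simple path between the poles has all edges valued 1
Conducts : (P : Network) {C : FaultType} → Fault C (L P) → (ℕ → Bool) → Set
Conducts P ρ σ = Σ (List (Fin (nodes P))) λ vs → Σ (List (Fin (L P))) λ es →
  Walk (ends P) (pole₁ P) (pole₂ P) vs es × Unique vs ×
  All (λ e → edgeVal P ρ σ e ≡ true) es

SameFun : (P : Network) {C : FaultType} → Fault C (L P) → Fault C (L P) → Set
SameFun P ρ δ = ∀ σ → Conducts P ρ σ ⇔ Conducts P δ σ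

data DTree (C : FaultType) (L : ℕ) : Set where
  leaf : Fault C L → DTree C L
  node : (ℕ → Bool) → DTree C L → DTree C L → DTree C L
  -- node σ t₀ t₁ : query f at σ, go to t₀ on value 0 and t₁ on value 1

depth : ∀ {C L} → DTree C L → ℕ
depth (leaf _)     = 0
depth (node _ l r) = suc (depth l ⊔ depth r)

data Runs (P : Network) {C : FaultType} (ρ : Fault C (L P))
     : DTree C (L P) → Fault C (L P) → Set where
  atLeaf : ∀ δ → Runs P ρ (leaf δ) δ
  go₁    : ∀ {σ t₀ t₁ δ} → Conducts P ρ σ → Runs P ρ t₁ δ → Runs P ρ (node σ t₀ t₁) δ
  go₀    : ∀ {σ t₀ t₁ δ} → ¬ Conducts P ρ σ → Runs P ρ t₀ δ → Runs P ρ (node σ t₀ t₁) δ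

Diagnoses : (C : FaultType) (P : Network) → DTree C (L P) → Set
Diagnoses C P T = ∀ (ρ : Fault C (L P)) δ → Runs P ρ T δ → SameFun P ρ δ

hAtLeast : FaultType → Network → ℕ → Set
hAtLeast C P k = ∀ (T : DTree C (L P)) → Diagnoses C P T → k Data.Nat.≤ depth T

-- For C ∋ 0 put the 2n edges x_0, …, x_{n-1}, x̄_0, …, x̄_{n-1} in parallel, for C ∋ 1 in
-- series; without faults the network computes a constant. For each tuple t ∈ {0,1}^n, fixing
-- to the constant c ∈ C every edge whose literal is ¬c at t gives a fault whose function
-- differs from that constant exactly at t (on x_0, …, x_{n-1}). Following the run of the
-- empty fault, each query separates it from at most one of these 2^n faults, so a tree
-- diagnosing all of them has a path of length at least 2^n.
module Submission where

open import Defs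
open import Data.Nat using (ℕ; zero; suc; _≤_; _<_; _*_; _^_; _+_; z≤n; s≤s; s≤s⁻¹; _≤?_; _<?_)
open import Data.Nat.Properties
  using (≤-trans; n≤1+n; ≤-<-trans; ≤-antisym; <-irrefl; ≰⇒>; m≤m⊔n; m≤n⊔m;
         ≮⇒≥; +-suc; +-identityʳ; +-monoˡ-≤; +-cancelˡ-<)
open import Data.Bool using (Bool; true; false; not; _xor_; if_then_else_)
open import Data.Bool.Properties using (_≟_; xor-same; ¬-not; not-¬)
open import Data.Fin using (Fin; toℕ; fromℕ; fromℕ<; inject₁; splitAt; _↑ˡ_; _↑ʳ_)
  renaming (zero to fz; suc to fs)
open import Data.Fin.Properties using (suc-injective; toℕ-inject₁; toℕ-injective; toℕ<n; toℕ-fromℕ; toℕ-fromℕ<; splitAt-↑ˡ; splitAt-↑ʳ)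
open import Data.Vec using (Vec; []; _∷_)
open import Data.List using (List; []; _∷_; length; map; filter; upTo)
open import Data.List.Properties using (length-map; length-upTo)
open import Data.List.Relation.Unary.All as All using (All; []; _∷_)
open import Data.List.Relation.Unary.All.Properties using (map⁺; map⁻; all-filter; filter⁻)
open import Data.List.Relation.Unary.AllPairs using ([]; _∷_)
open import Data.List.Relation.Unary.Any using (here; there)
open import Data.List.Relation.Unary.Unique.Propositional using (Unique)
open import Data.List.Relation.Unary.Unique.Propositional.Properties
  using (upTo⁺) renaming (map⁺ to Unique-map⁺)
open import Data.List.Membership.Propositional using (_∈_)
open import Data.List.Membership.Propositional.Properties using (∈-upTo⁺; ∈-upTo⁻)
open import Data.Maybe using (just; nothing)
open import Data.Product using (Σ; ∃; _×_; _,_; uncurry)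
open import Data.Sum using (_⊎_; inj₁; inj₂)
open import Data.Empty using (⊥-elim)
open import Function using (_∘_; const)
open import Function.Bundles using (_⇔_; mk⇔; Equivalence)
import Function.Properties.Equivalence as ⇔
open import Relation.Nullary using (¬_; Dec; yes; no; does; ¬?)
open import Level using (0ℓ)
open import Relation.Unary using (Pred; Decidable)
open import Relation.Binary.PropositionalEquality
  using (_≡_; _≢_; refl; sym; trans; cong; subst; module ≡-Reasoning)

open Equivalence using (to; from)

polarity-with-value : ∀ τ j b → ∃ λ p → evalLit τ (lit j p) ≡ b
polarity-with-value τ j false with τ j in eq
... | true  = false , cong not eq
... | false = true , eq
polarity-with-value τ j true with τ j in eq
... | true  = true , eq
... | false = false , cong not eq

evalLit-flip : ∀ {σ τ} j p → σ j ≢ τ j → evalLit σ (lit j p) ≡ not (evalLit τ (lit j p))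
evalLit-flip j true  σj≢τj = ¬-not σj≢τj
evalLit-flip j false σj≢τj = cong not (¬-not σj≢τj)

HasBothLiterals : Network → ℕ → Set
HasBothLiterals P n = ∀ (i : Fin n) p → ∃ λ e → label P e ≡ lit (toℕ i) p

DisagreeBelow : ℕ → (ℕ → Bool) → (ℕ → Bool) → Set
DisagreeBelow n σ τ = ∃ λ (i : Fin n) → σ (toℕ i) ≢ τ (toℕ i)

noFault : ∀ {C L} → Fault C L
noFault _ = nothing

noFault-takes : ∀ {C} P {m} → HasBothLiterals P (suc m) →
  ∀ σ b → ∃ λ e → edgeVal P {C} noFault σ e ≡ b
noFault-takes P both σ b with polarity-with-value σ 0 b
... | p , value with both fz p
...   | e , label≡ = e , trans (cong (evalLit σ) label≡) value

stuckAt : ∀ {C} (c : Bool) → InC C c → (P : Network) → (ℕ → Bool) → Fault C (L P)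
stuckAt c c∈C P τ e = if evalLit τ (label P e) xor c then just (c , c∈C) else nothing

module _ {C : FaultType} (c : Bool) (c∈C : InC C c) (P : Network) (τ : ℕ → Bool) where

  edgeVal-stuckAt : ∀ σ e → edgeVal P (stuckAt c c∈C P τ) σ e ≡
    (if evalLit τ (label P e) xor c then c else evalLit σ (label P e))
  edgeVal-stuckAt σ e with evalLit τ (label P e) xor c
  ... | true  = refl
  ... | false = refl

  stuckAt-at : ∀ e → edgeVal P (stuckAt c c∈C P τ) τ e ≡ c
  stuckAt-at e = trans (edgeVal-stuckAt τ e) (if-xor (evalLit τ (label P e)) c)
    where
    if-xor : ∀ b c → (if b xor c then c else b) ≡ c
    if-xor false false = refl
    if-xor false true  = refl
    if-xor true  false = refl
    if-xor true  true  = refl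

  stuckAt-free : ∀ σ e → evalLit τ (label P e) ≡ c →
    edgeVal P (stuckAt c c∈C P τ) σ e ≡ evalLit σ (label P e)
  stuckAt-free σ e τe≡c rewrite edgeVal-stuckAt σ e | τe≡c | xor-same c = refl

  stuckAt-away : ∀ {n} → HasBothLiterals P n → ∀ σ → DisagreeBelow n σ τ →
    ∃ λ e → edgeVal P (stuckAt c c∈C P τ) σ e ≡ not c
  stuckAt-away both σ (i , σi≢τi) with polarity-with-value τ (toℕ i) c
  ... | p , value with both i p
  ...   | e , label≡ = e , (begin
    edgeVal P (stuckAt c c∈C P τ) σ e ≡⟨ stuckAt-free σ e (trans (cong (evalLit τ) label≡) value) ⟩
    evalLit σ (label P e)             ≡⟨ cong (evalLit σ) label≡ ⟩
    evalLit σ (lit (toℕ i) p)         ≡⟨ evalLit-flip (toℕ i) p σi≢τi ⟩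
    not (evalLit τ (lit (toℕ i) p))   ≡⟨ cong not value ⟩
    not c                             ∎)
    where open ≡-Reasoning

⟦_⟧ : ∀ {n} → Vec Bool n → ℕ → Bool
⟦ [] ⟧    _       = false
⟦ b ∷ t ⟧ zero    = b
⟦ b ∷ t ⟧ (suc i) = ⟦ t ⟧ i

module _ {A : Set} {P : Pred A 0ℓ} (P? : Decidable P) where

  length-filter-∁ : ∀ xs → length (filter P? xs) + length (filter (¬? ∘ P?) xs) ≡ length xs
  length-filter-∁ [] = refl
  length-filter-∁ (x ∷ xs) with does (P? x)
  ... | true  = cong suc (length-filter-∁ xs)
  ... | false = trans (+-suc _ _) (cong suc (length-filter-∁ xs))

  filter-or-∁-short : ∀ xs k → length xs < k + k →
    length (filter P? xs) < k ⊎ length (filter (¬? ∘ P?) xs) < k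
  filter-or-∁-short xs k short with length (filter P? xs) <? k
  ... | yes fewer = inj₁ fewer
  ... | no  more  = inj₂ (+-cancelˡ-< k _ k (≤-<-trans (+-monoˡ-≤ _ (≮⇒≥ more))
                      (subst (_< k + k) (sym (length-filter-∁ xs)) short)))

x₀? : Decidable (λ (σ : ℕ → Bool) → σ 0 ≡ true)
x₀? σ = σ 0 ≟ true

avoiding-cons : ∀ {n} b (t : Vec Bool n) {σs} →
  All (λ σ → DisagreeBelow n σ ⟦ t ⟧) (map (_∘ suc) σs) →
  All (λ σ → DisagreeBelow (suc n) σ ⟦ b ∷ t ⟧) σs
avoiding-cons b t = All.map (λ (i , σi≢ti) → fs i , σi≢ti) ∘ map⁻

-- The first bit of t is chosen on the side (σ 0 = 1 or σ 0 = 0) holding fewer than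
-- 2^n queries; the queries on the other side already disagree with t at x_0.
avoiding-tuple : ∀ n (σs : List (ℕ → Bool)) → length σs < 2 ^ n →
  ∃ λ (t : Vec Bool n) → All (λ σ → DisagreeBelow n σ ⟦ t ⟧) σs
avoiding-tuple zero    []      _         = [] , []
avoiding-tuple zero    (_ ∷ _) (s≤s ())
avoiding-tuple (suc n) σs short
  with filter-or-∁-short x₀? σs (2 ^ n)
         (subst (length σs <_) (cong (2 ^ n +_) (+-identityʳ (2 ^ n))) short)
... | inj₁ fewer with avoiding-tuple n (map (_∘ suc) (filter x₀? σs))
                        (subst (_< 2 ^ n) (sym (length-map (_∘ suc) (filter x₀? σs))) fewer)
...   | t , apart = true ∷ t ,
        filter⁻ x₀? (avoiding-cons true t apart) (All.map (fz ,_) (all-filter (¬? ∘ x₀?) σs))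
avoiding-tuple (suc n) σs short
    | inj₂ fewer with avoiding-tuple n (map (_∘ suc) (filter (¬? ∘ x₀?) σs))
                        (subst (_< 2 ^ n) (sym (length-map (_∘ suc) (filter (¬? ∘ x₀?) σs))) fewer)
...   | t , apart = false ∷ t ,
        filter⁻ x₀? (All.map (λ σ₀≡1 → fz , not-¬ σ₀≡1) (all-filter x₀? σs)) (avoiding-cons false t apart)

module Adversary (P : Network) {C : FaultType} (ρ₀ : Fault C (L P))
                 (conducts₀? : ∀ σ → Dec (Conducts P ρ₀ σ)) where

  AgreeAt : Fault C (L P) → (ℕ → Bool) → Set
  AgreeAt ρ σ = Conducts P ρ₀ σ ⇔ Conducts P ρ σ

  queries : DTree C (L P) → List (ℕ → Bool)
  queries (leaf _) = []
  queries (node σ t₀ t₁) with conducts₀? σ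
  ... | yes _ = σ ∷ queries t₁
  ... | no  _ = σ ∷ queries t₀

  output : DTree C (L P) → Fault C (L P)
  output (leaf δ) = δ
  output (node σ t₀ t₁) with conducts₀? σ
  ... | yes _ = output t₁
  ... | no  _ = output t₀

  length-queries≤depth : ∀ T → length (queries T) ≤ depth T
  length-queries≤depth (leaf _) = z≤n
  length-queries≤depth (node σ t₀ t₁) with conducts₀? σ
  ... | yes _ = s≤s (≤-trans (length-queries≤depth t₁) (m≤n⊔m (depth t₀) (depth t₁)))
  ... | no  _ = s≤s (≤-trans (length-queries≤depth t₀) (m≤m⊔n (depth t₀) (depth t₁)))

  runs-output : ∀ ρ T → All (AgreeAt ρ) (queries T) → Runs P ρ T (output T)
  runs-output ρ (leaf δ) [] = atLeaf δ
  runs-output ρ (node σ t₀ t₁) agree with conducts₀? σ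
  runs-output ρ (node σ t₀ t₁) (agreeσ ∷ agree) | yes c₀ =
    go₁ (to agreeσ c₀) (runs-output ρ t₁ agree)
  runs-output ρ (node σ t₀ t₁) (agreeσ ∷ agree) | no ¬c₀ =
    go₀ (¬c₀ ∘ from agreeσ) (runs-output ρ t₀ agree)

  indistinguishable : ∀ T → Diagnoses C P T →
    ∀ ρ → All (AgreeAt ρ) (queries T) → SameFun P ρ₀ ρ
  indistinguishable T diagnoses ρ agree σ =
    ⇔.trans (diagnoses ρ₀ _ (runs-output ρ₀ T (All.universal (λ _ → ⇔.refl) _)) σ)
            (⇔.sym (diagnoses ρ _ (runs-output ρ T agree) σ))

  hAtLeast-2^ : ∀ n (ρ : Vec Bool n → Fault C (L P)) →
    (∀ t → ¬ SameFun P ρ₀ (ρ t)) →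
    (∀ t σ → DisagreeBelow n σ ⟦ t ⟧ → AgreeAt (ρ t) σ) →
    hAtLeast C P (2 ^ n)
  hAtLeast-2^ n ρ distinct agree T diagnoses with 2 ^ n ≤? depth T
  ... | yes deep = deep
  ... | no shallow
    with avoiding-tuple n (queries T) (≤-<-trans (length-queries≤depth T) (≰⇒> shallow))
  ...   | t , apart =
    ⊥-elim (distinct t (indistinguishable T diagnoses (ρ t) (All.map (agree t _) apart)))

Reachable : ∀ {k L} → (Fin L → Fin k × Fin k) → Fin k → Fin k → Set
Reachable ends u w = Σ (List _) λ vs → Σ (List _) λ es → Walk ends u w vs es

parallel : ∀ m → (Fin (suc m) → Literal) → Network
parallel m ℓ = record
  { nodes = 2 ; L = suc m ; ends = λ _ → (fz , fs fz) ; label = ℓ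
  ; noLoop = λ _ () ; pole₁ = fz ; pole₂ = fs fz ; poles≢ = λ ()
  ; connected = walk }
  where
  walk : ∀ u v → Reachable {L = suc m} (λ _ → (fz , fs fz)) u v
  walk fz      fz      = _ , _ , here fz
  walk fz      (fs fz) = _ , _ , step fz (inj₁ refl) (here (fs fz))
  walk (fs fz) fz      = _ , _ , step fz (inj₂ refl) (here fz)
  walk (fs fz) (fs fz) = _ , _ , here (fs fz)

parallel-conducts : ∀ m ℓ {C} (ρ : Fault C (suc m)) σ →
  Conducts (parallel m ℓ) ρ σ ⇔ ∃ λ e → edgeVal (parallel m ℓ) ρ σ e ≡ true
parallel-conducts m ℓ ρ σ = mk⇔ first-edge single-edge
  where
  first-edge : Conducts (parallel m ℓ) ρ σ → ∃ λ e → edgeVal (parallel m ℓ) ρ σ e ≡ true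
  first-edge (_ , _ , step e _ _ , _ , closed ∷ _) = e , closed
  single-edge : (∃ λ e → edgeVal (parallel m ℓ) ρ σ e ≡ true) → Conducts (parallel m ℓ) ρ σ
  single-edge (e , closed) =
    _ , _ , step e (inj₁ refl) (here (fs fz)) , ((λ ()) ∷ []) ∷ [] ∷ [] , closed ∷ []

parallel-hAtLeast : ∀ {C} → InC C false → ∀ m ℓ n → HasBothLiterals (parallel m ℓ) (suc n) →
  hAtLeast C (parallel m ℓ) (2 ^ suc n)
parallel-hAtLeast {C} 0∈C m ℓ n both =
  Adversary.hAtLeast-2^ P ρ₀ (yes ∘ conducts₀) (suc n) ρ distinct agree
  where
  P : Network
  P = parallel m ℓ
  ρ₀ : Fault C (suc m)
  ρ₀ = noFault {C}
  ρ : Vec Bool (suc n) → Fault C (suc m)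
  ρ t = stuckAt false 0∈C P ⟦ t ⟧
  conducts : ∀ ρ σ → Conducts P ρ σ ⇔ ∃ λ e → edgeVal P ρ σ e ≡ true
  conducts = parallel-conducts m ℓ {C}
  conducts₀ : ∀ σ → Conducts P ρ₀ σ
  conducts₀ σ = from (conducts ρ₀ σ) (noFault-takes {C} P both σ true)
  distinct : ∀ t → ¬ SameFun P ρ₀ (ρ t)
  distinct t same with to (conducts (ρ t) ⟦ t ⟧) (to (same ⟦ t ⟧) (conducts₀ ⟦ t ⟧))
  ... | e , closed with () ← trans (sym closed) (stuckAt-at false 0∈C P ⟦ t ⟧ e)
  agree : ∀ t σ → DisagreeBelow (suc n) σ ⟦ t ⟧ → Conducts P ρ₀ σ ⇔ Conducts P (ρ t) σ
  agree t σ apart = mk⇔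
    (const (from (conducts (ρ t) σ) (stuckAt-away false 0∈C P ⟦ t ⟧ both σ apart)))
    (const (conducts₀ σ))

chain : ∀ N → Fin N → Fin (suc N) × Fin (suc N)
chain N e = inject₁ e , fs e

reachable-trans : ∀ {k L} {ends : Fin L → Fin k × Fin k} {u v w} →
  Reachable ends u v → Reachable ends v w → Reachable ends u w
reachable-trans (_ , _ , here _) reach = reach
reachable-trans (_ , _ , step e j walk) reach with reachable-trans (_ , _ , walk) reach
... | _ , _ , walk′ = _ , _ , step e j walk′

shift : ∀ {N u w vs es} → Walk (chain N) u w vs es →
  Walk (chain (suc N)) (fs u) (fs w) (map fs vs) (map fs es)
shift (here v)               = here (fs v)
shift (step e (inj₁ refl) w) = step (fs e) (inj₁ refl) (shift w)
shift (step e (inj₂ refl) w) = step (fs e) (inj₂ refl) (shift w)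

reachable-from-0 : ∀ N v → Reachable (chain N) fz v
reachable-from-0 N       fz     = _ , _ , here fz
reachable-from-0 (suc N) (fs v) with reachable-from-0 N v
... | _ , _ , walk = _ , _ , step fz (inj₁ refl) (shift walk)

reachable-to-0 : ∀ N v → Reachable (chain N) v fz
reachable-to-0 N       fz     = _ , _ , here fz
reachable-to-0 (suc N) (fs v) with reachable-to-0 N v
... | _ , _ , walk = reachable-trans (_ , _ , shift walk) (_ , _ , step fz (inj₂ refl) (here fz))

simple-path : ∀ N → Σ (List _) λ vs → Σ (List _) λ es →
  Walk (chain N) fz (fromℕ N) vs es × Unique vs
simple-path zero = _ , _ , here fz , [] ∷ []
simple-path (suc N) with simple-path N
... | vs , _ , walk , unique = _ , _ , step fz (inj₁ refl) (shift walk) ,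
      map⁺ (All.universal (λ _ ()) vs) ∷ Unique-map⁺ suc-injective unique

crosses : ∀ {N u w vs es} (e : Fin N) → Walk (chain N) u w vs es →
  toℕ u ≤ toℕ e → toℕ e < toℕ w → e ∈ es
crosses e (here v) u≤e e<w = ⊥-elim (<-irrefl refl (≤-<-trans u≤e e<w))
crosses e (step {v = v} e′ j walk) u≤e e<w with toℕ v ≤? toℕ e
... | yes v≤e = there (crosses e walk v≤e e<w)
crosses e (step e′ (inj₁ refl) walk) u≤e e<w | no v≰e = here (toℕ-injective
  (≤-antisym (s≤s⁻¹ (≰⇒> v≰e)) (subst (_≤ toℕ e) (toℕ-inject₁ e′) u≤e)))
crosses e (step e′ (inj₂ refl) walk) u≤e e<w | no v≰e =
  ⊥-elim (v≰e (subst (_≤ toℕ e) (sym (toℕ-inject₁ e′)) (≤-trans (n≤1+n (toℕ e′)) u≤e)))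

inject₁≢suc : ∀ {N} (e : Fin N) → inject₁ e ≢ fs e
inject₁≢suc fz     = λ ()
inject₁≢suc (fs e) = inject₁≢suc e ∘ suc-injective

series : ∀ m → (Fin (suc m) → Literal) → Network
series m ℓ = record
  { nodes = suc (suc m) ; L = suc m ; ends = chain (suc m) ; label = ℓ
  ; noLoop = inject₁≢suc ; pole₁ = fz ; pole₂ = fromℕ (suc m) ; poles≢ = λ ()
  ; connected = λ u v → reachable-trans (reachable-to-0 (suc m) u) (reachable-from-0 (suc m) v) }

series-conducts : ∀ m ℓ {C} (ρ : Fault C (suc m)) σ →
  Conducts (series m ℓ) ρ σ ⇔ (∀ e → edgeVal (series m ℓ) ρ σ e ≡ true)
series-conducts m ℓ ρ σ = mk⇔ every-edge whole-chain
  where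
  every-edge : Conducts (series m ℓ) ρ σ → ∀ e → edgeVal (series m ℓ) ρ σ e ≡ true
  every-edge (_ , _ , walk , _ , closed) e = All.lookup closed
    (crosses e walk z≤n (subst (toℕ e <_) (sym (toℕ-fromℕ (suc m))) (toℕ<n e)))
  whole-chain : (∀ e → edgeVal (series m ℓ) ρ σ e ≡ true) → Conducts (series m ℓ) ρ σ
  whole-chain closed with simple-path (suc m)
  ... | _ , es , walk , unique = _ , _ , walk , unique , All.universal closed es

series-hAtLeast : ∀ {C} → InC C true → ∀ m ℓ n → HasBothLiterals (series m ℓ) (suc n) →
  hAtLeast C (series m ℓ) (2 ^ suc n)
series-hAtLeast {C} 1∈C m ℓ n both =
  Adversary.hAtLeast-2^ P ρ₀ (no ∘ blocked₀) (suc n) ρ distinct agree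
  where
  P : Network
  P = series m ℓ
  ρ₀ : Fault C (suc m)
  ρ₀ = noFault {C}
  ρ : Vec Bool (suc n) → Fault C (suc m)
  ρ t = stuckAt true 1∈C P ⟦ t ⟧
  conducts : ∀ ρ σ → Conducts P ρ σ ⇔ (∀ e → edgeVal P ρ σ e ≡ true)
  conducts = series-conducts m ℓ {C}
  blocked : ∀ ρ σ e → edgeVal P ρ σ e ≡ false → ¬ Conducts P ρ σ
  blocked ρ σ e open′ closed with () ← trans (sym open′) (to (conducts ρ σ) closed e)
  blocked₀ : ∀ σ → ¬ Conducts P ρ₀ σ
  blocked₀ σ = uncurry (blocked ρ₀ σ) (noFault-takes {C} P both σ false)
  distinct : ∀ t → ¬ SameFun P ρ₀ (ρ t)
  distinct t same = blocked₀ ⟦ t ⟧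
    (from (same ⟦ t ⟧) (from (conducts (ρ t) ⟦ t ⟧) (stuckAt-at true 1∈C P ⟦ t ⟧)))
  agree : ∀ t σ → DisagreeBelow (suc n) σ ⟦ t ⟧ → Conducts P ρ₀ σ ⇔ Conducts P (ρ t) σ
  agree t σ apart = mk⇔
    (⊥-elim ∘ blocked₀ σ)
    (⊥-elim ∘ uncurry (blocked (ρ t) σ) (stuckAt-away true 1∈C P ⟦ t ⟧ both σ apart))

signedLiteral : ∀ {n} → Fin n ⊎ Fin n → Literal
signedLiteral (inj₁ i) = lit (toℕ i) true
signedLiteral (inj₂ i) = lit (toℕ i) false

literal : ∀ n → Fin (n + n) → Literal
literal n = signedLiteral ∘ splitAt n

literal-both : ∀ n (i : Fin n) p → ∃ λ e → literal n e ≡ lit (toℕ i) p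
literal-both n i true  = i ↑ˡ n , cong signedLiteral (splitAt-↑ˡ n i n)
literal-both n i false = n ↑ʳ i , cong signedLiteral (splitAt-↑ʳ n n i)

var-literal< : ∀ n e → Literal.var (literal n e) < n
var-literal< n e with splitAt n e
... | inj₁ i = toℕ<n i
... | inj₂ i = toℕ<n i

literal-inputVars : ∀ n → Σ (List ℕ) λ vs → Unique vs × length vs ≡ n ×
  (∀ i → (i ∈ vs) ⇔ ∃ λ (e : Fin (n + n)) → Literal.var (literal n e) ≡ i)
literal-inputVars n = upTo n , upTo⁺ n , length-upTo n , λ i → mk⇔ (occurs i) (listed i)
  where
  occurs : ∀ i → i ∈ upTo n → ∃ λ e → Literal.var (literal n e) ≡ i
  occurs i i∈ with literal-both n (fromℕ< (∈-upTo⁻ i∈)) true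
  ... | e , literal≡ = e , trans (cong Literal.var literal≡) (toℕ-fromℕ< (∈-upTo⁻ i∈))
  listed : ∀ i → (∃ λ e → Literal.var (literal n e) ≡ i) → i ∈ upTo n
  listed i (e , var≡i) = ∈-upTo⁺ (subst (_< n) var≡i (var-literal< n e))

n+n≡2*n : ∀ n → n + n ≡ 2 * n
n+n≡2*n n = cong (n +_) (sym (+-identityʳ n))

theorem1 : (C : FaultType) (n : ℕ) → 1 ≤ n →
    Σ Network λ P → HasInputVars P n × L P ≡ 2 * n × hAtLeast C P (2 ^ n)
theorem1 C0  (suc n) _ = parallel _ (literal (suc n)) , literal-inputVars (suc n) , n+n≡2*n (suc n) ,
  parallel-hAtLeast refl _ _ n (literal-both (suc n))
theorem1 C1  (suc n) _ = series _ (literal (suc n)) , literal-inputVars (suc n) , n+n≡2*n (suc n) ,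
  series-hAtLeast refl _ _ n (literal-both (suc n))
theorem1 C01 (suc n) _ = series _ (literal (suc n)) , literal-inputVars (suc n) , n+n≡2*n (suc n) ,
  series-hAtLeast refl _ _ n (literal-both (suc n))
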